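{- For every integer $k \ge 0$ there exists a tournament $T_k$ on $3^k$ vertices in which every vertex has out-degree $\frac{3^k-1}{2}$, and such that for every set $X \subseteq V(T_k)$ of size $|X| \le \frac{3^k-1}{2}$ we have $$\delta^+(T_k[X]) \le \frac{\frac{3^k-1}{2} - k}{2}.$$
   Context: Digraphs have no loops or parallel arcs. A tournament is a digraph in which for every pair of distinct vertices $u,v$ exactly one of the arcs $(u,v)$, $(v,u)$ is present. For $X \subseteq V(D)$, $D[X]$ denotes the subdigraph induced by $X$ (vertex set $X$ and all arcs of $D$ between vertices of $X$). $\delta^+(D)$ denotes the minimum out-degree of $D$ (the smallest out-degree among its vertices), defined as $0$ when $D$ is the empty digraph. -}

module Defs where

open import Data.Nat using (ℕ; zero; suc; _+_; _⊓_)
open import Data.Bool using (Bool; true; false; _∧_)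
open import Data.Fin using (Fin)
open import Data.Fin.Subset using (Subset)
open import Data.List using (List; []; _∷_; filter; length; allFin)
open import Data.Vec using (lookup)
open import Data.Product using (_×_)
open import Data.Sum using (_⊎_)
open import Relation.Binary.PropositionalEquality using (_≡_; _≢_)

-- A digraph on vertex set Fin n, given by its arc indicator:
-- D u v ≡ true  iff  (u , v) is an arc.
Digraph : ℕ → Set
Digraph n = Fin n → Fin n → Bool

record IsTournament {n : ℕ} (D : Digraph n) : Set where
  field
    loopless   : ∀ u → D u u ≡ false
    exactlyOne : ∀ u v → u ≢ v →
                 (D u v ≡ true × D v u ≡ false) ⊎ (D u v ≡ false × D v u ≡ true)

members : {n : ℕ} → Subset n → List (Fin n)
members {n} X = filter (λ v → Data.Bool._≟_ (lookup X v) true) (allFin n)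
  where import Data.Bool

outDegIn : {n : ℕ} → Digraph n → Subset n → Fin n → ℕ
outDegIn D X v = length (filter (λ w → Data.Bool._≟_ (D v w) true) (members X))
  where import Data.Bool

outDeg : {n : ℕ} → Digraph n → Fin n → ℕ
outDeg D v = length (filter (λ w → Data.Bool._≟_ (D v w) true) (allFin _))
  where import Data.Bool

minOr : ℕ → List ℕ → ℕ
minOr d []       = d
minOr d (x ∷ []) = x
minOr d (x ∷ xs@(_ ∷ _)) = x ⊓ minOr d xs

-- δ⁺(D[X]) : minimum out-degree of the induced subdigraph, 0 if X = ∅
minOutDegIn : {n : ℕ} → Digraph n → Subset n → ℕ
minOutDegIn D X = minOr 0 (Data.List.map (outDegIn D X) (members X))
  where import Data.List

{-# OPTIONS --safe #-}
-- T (k + 1) consists of three copies of T k, copy i dominating copy i + 1 (indices mod 3), so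
-- it is regular of degree h (k + 1) = 3 h k + 1 where h k = (3^k - 1) / 2. The bound comes from
-- a stronger statement, proved by induction on k: every nonempty vertex set S contains a vertex
-- whose out-degree d in S satisfies 2d + k ≤ h k, or else 2d + k + h k + 2 ≤ 2|S|. In the step
-- one picks a copy i meeting S such that either copy i + 1 meets S in at most h k vertices and
-- copies i, i + 1 together in at most 3^k, or both copy i and copy i - 1 meet S in more than
-- h k vertices; the vertex of copy i given by induction has out-degree d + |S ∩ copy (i + 1)|.
module Submission where

open import Defs
open import Function using (_∘_)
open import Data.Nat using (ℕ; zero; suc; _+_; _*_; _^_; _≤_; _<_; z≤n; s≤s; _<?_; _≤?_)
open import Data.Nat.Properties
open import Data.Nat.Tactic.RingSolver using (solve-∀)
open import Data.Bool using (Bool; true; false; _∧_; if_then_else_)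
open import Data.Bool.Properties using (∧-identityʳ; ∧-zeroʳ) renaming (_≟_ to _≟ᵇ_)
open import Data.Fin using (Fin; zero; suc; _↑ˡ_; _↑ʳ_; combine; remQuot)
open import Data.Fin.Patterns using (0F; 1F; 2F)
open import Data.Fin.Properties using (remQuot-combine; combine-remQuot; combine-surjective)
open import Data.Fin.Subset using (Subset; ∣_∣)
open import Data.List using (List; []; _∷_; filter; length; map; tabulate)
open import Data.List.Membership.Propositional using (_∈_)
open import Data.List.Membership.Propositional.Properties using (∈-filter⁺; ∈-allFin; ∈-map⁺)
open import Data.List.Relation.Unary.Any using (here; there)
import Data.Vec as Vec
open import Data.Product using (Σ; _×_; _,_; ∃; uncurry)
open import Data.Sum using (_⊎_; inj₁; inj₂)
open import Data.Empty using (⊥-elim)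
open import Relation.Binary.PropositionalEquality
open import Relation.Nullary using (yes; no)

count : ∀ {n} → (Fin n → Bool) → ℕ
count {zero}  f = 0
count {suc n} f = (if f zero then 1 else 0) + count (f ∘ suc)

count-cong : ∀ {n} {f g : Fin n → Bool} → (∀ i → f i ≡ g i) → count f ≡ count g
count-cong {zero}  f≗g = refl
count-cong {suc n} f≗g = cong₂ _+_ (cong (λ b → if b then 1 else 0) (f≗g zero)) (count-cong (f≗g ∘ suc))

count-true : ∀ n → count {n} (λ _ → true) ≡ n
count-true zero    = refl
count-true (suc n) = cong suc (count-true n)

count-false : ∀ n → count {n} (λ _ → false) ≡ 0
count-false zero    = refl
count-false (suc n) = count-false n

count-∧-true : ∀ {n} (f : Fin n → Bool) → count (λ i → f i ∧ true) ≡ count f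
count-∧-true f = count-cong (λ i → ∧-identityʳ (f i))

count-∧-false : ∀ {n} (f : Fin n → Bool) → count (λ i → f i ∧ false) ≡ 0
count-∧-false {n} f = trans (count-cong (λ i → ∧-zeroʳ (f i))) (count-false n)

count-≤ : ∀ {n} (f : Fin n → Bool) → count f ≤ n
count-≤ {zero}  f = z≤n
count-≤ {suc n} f with f zero
... | true  = s≤s (count-≤ (f ∘ suc))
... | false = m≤n⇒m≤1+n (count-≤ (f ∘ suc))

count-↑ : ∀ m {n} (f : Fin (m + n) → Bool) → count f ≡ count (f ∘ (_↑ˡ n)) + count (f ∘ (m ↑ʳ_))
count-↑ zero    f = refl
count-↑ (suc m) f = trans (cong (b +_) (count-↑ m (f ∘ suc))) (sym (+-assoc b _ _))
  where b = if f zero then 1 else 0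

sum₃ : (Fin 3 → ℕ) → ℕ
sum₃ a = a 0F + (a 1F + a 2F)

sum₃-cong : ∀ {a b : Fin 3 → ℕ} → (∀ i → a i ≡ b i) → sum₃ a ≡ sum₃ b
sum₃-cong a≗b = cong₂ _+_ (a≗b 0F) (cong₂ _+_ (a≗b 1F) (a≗b 2F))

length-filter-tabulate : ∀ {A : Set} {n} (g : Fin n → A) (P : A → Bool) →
  length (filter (λ x → P x ≟ᵇ true) (tabulate g)) ≡ count (P ∘ g)
length-filter-tabulate {n = zero}  g P = refl
length-filter-tabulate {n = suc n} g P with P (g zero)
... | true  = cong suc (length-filter-tabulate (g ∘ suc) P)
... | false = length-filter-tabulate (g ∘ suc) P

length-filter-filter-tabulate : ∀ {A : Set} {n} (g : Fin n → A) (P Q : A → Bool) →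
  length (filter (λ x → Q x ≟ᵇ true) (filter (λ x → P x ≟ᵇ true) (tabulate g)))
    ≡ count (λ i → P (g i) ∧ Q (g i))
length-filter-filter-tabulate {n = zero}  g P Q = refl
length-filter-filter-tabulate {n = suc n} g P Q with P (g zero)
... | false = length-filter-filter-tabulate (g ∘ suc) P Q
... | true with Q (g zero)
...   | true  = cong suc (length-filter-filter-tabulate (g ∘ suc) P Q)
...   | false = length-filter-filter-tabulate (g ∘ suc) P Q

outDegreeIn : ∀ {n} → Digraph n → (Fin n → Bool) → Fin n → ℕ
outDegreeIn D S v = count (λ w → S w ∧ D v w)

outDeg≡count : ∀ {n} (D : Digraph n) v → outDeg D v ≡ count (D v)
outDeg≡count D v = length-filter-tabulate (λ i → i) (D v)

outDegIn≡outDegreeIn : ∀ {n} (D : Digraph n) X v → outDegIn D X v ≡ outDegreeIn D (Vec.lookup X) v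
outDegIn≡outDegreeIn D X v = length-filter-filter-tabulate (λ i → i) (Vec.lookup X) (D v)

∣∣≡count : ∀ {n} (X : Subset n) → ∣ X ∣ ≡ count (Vec.lookup X)
∣∣≡count Vec.[]           = refl
∣∣≡count (true Vec.∷ X)  = cong suc (∣∣≡count X)
∣∣≡count (false Vec.∷ X) = ∣∣≡count X

minOr-≤ : ∀ {d x} {xs : List ℕ} → x ∈ xs → minOr d xs ≤ x
minOr-≤ {xs = _ ∷ []}    (here refl) = ≤-refl
minOr-≤ {xs = _ ∷ _ ∷ _} (here refl) = m⊓n≤m _ _
minOr-≤ {xs = y ∷ _ ∷ _} (there x∈) = ≤-trans (m⊓n≤n y _) (minOr-≤ x∈)

minOutDegIn-≤ : ∀ {n} (D : Digraph n) X {v} → Vec.lookup X v ≡ true →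
  minOutDegIn D X ≤ outDegreeIn D (Vec.lookup X) v
minOutDegIn-≤ D X {v} v∈X = ≤-trans
  (minOr-≤ (∈-map⁺ (outDegIn D X) (∈-filter⁺ (λ w → Vec.lookup X w ≟ᵇ true) (∈-allFin v) v∈X)))
  (≤-reflexive (outDegIn≡outDegreeIn D X v))

minOutDegIn-∅ : ∀ {n} (D : Digraph n) X → count (Vec.lookup X) ≡ 0 → minOutDegIn D X ≡ 0
minOutDegIn-∅ D X ∣X∣≡0 =
  minOr-map-[] {xs = members X} (trans (length-filter-tabulate (λ i → i) (Vec.lookup X)) ∣X∣≡0)
  where
  minOr-map-[] : ∀ {A : Set} {f : A → ℕ} {xs} → length xs ≡ 0 → minOr 0 (map f xs) ≡ 0
  minOr-map-[] {xs = []} _ = refl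

next : Fin 3 → Fin 3
next 0F = 1F
next 1F = 2F
next 2F = 0F

module _ {n : ℕ} where

  part : (Fin (3 * n) → Bool) → Fin 3 → Fin n → Bool
  part S i = S ∘ combine i

  count-combine : (f : Fin (3 * n) → Bool) → count f ≡ sum₃ (count ∘ part f)
  count-combine f = begin
    count f                           ≡⟨ count-↑ n f ⟩
    c 0F + count f₁                   ≡⟨ cong (c 0F +_) (count-↑ n f₁) ⟩
    c 0F + (c 1F + count f₂)          ≡⟨ cong (λ x → c 0F + (c 1F + x)) (count-↑ n f₂) ⟩
    c 0F + (c 1F + (c 2F + 0))        ≡⟨ cong (λ x → c 0F + (c 1F + x)) (+-identityʳ _) ⟩
    sum₃ c                            ∎
    where
    open ≡-Reasoning
    c : Fin 3 → ℕ
    c = count ∘ part f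
    f₁ : Fin (2 * n) → Bool
    f₁ = f ∘ (n ↑ʳ_)
    f₂ : Fin (1 * n) → Bool
    f₂ = f₁ ∘ (n ↑ʳ_)

  blowUpArc : Digraph n → Fin 3 × Fin n → Fin 3 × Fin n → Bool
  blowUpArc D (0F , w) (0F , z) = D w z
  blowUpArc D (1F , w) (1F , z) = D w z
  blowUpArc D (2F , w) (2F , z) = D w z
  blowUpArc D (0F , _) (1F , _) = true
  blowUpArc D (1F , _) (2F , _) = true
  blowUpArc D (2F , _) (0F , _) = true
  blowUpArc D _        _        = false

  blowUp : Digraph n → Digraph (3 * n)
  blowUp D u v = blowUpArc D (remQuot n u) (remQuot n v)

  blowUp-combine : (D : Digraph n) (i j : Fin 3) (w z : Fin n) →
                   blowUp D (combine i w) (combine j z) ≡ blowUpArc D (i , w) (j , z)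
  blowUp-combine D i j w z = cong₂ (blowUpArc D) (remQuot-combine i w) (remQuot-combine j z)

  module _ {D : Digraph n} (tournament : IsTournament D) where
    open IsTournament tournament

    blowUpArc-loopless : ∀ p → blowUpArc D p p ≡ false
    blowUpArc-loopless (0F , w) = loopless w
    blowUpArc-loopless (1F , w) = loopless w
    blowUpArc-loopless (2F , w) = loopless w

    blowUpArc-exactlyOne : ∀ p q → p ≢ q →
      (blowUpArc D p q ≡ true × blowUpArc D q p ≡ false) ⊎ (blowUpArc D p q ≡ false × blowUpArc D q p ≡ true)
    blowUpArc-exactlyOne (0F , w) (0F , z) p≢q = exactlyOne w z (p≢q ∘ cong (0F ,_))
    blowUpArc-exactlyOne (1F , w) (1F , z) p≢q = exactlyOne w z (p≢q ∘ cong (1F ,_))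
    blowUpArc-exactlyOne (2F , w) (2F , z) p≢q = exactlyOne w z (p≢q ∘ cong (2F ,_))
    blowUpArc-exactlyOne (0F , _) (1F , _) _   = inj₁ (refl , refl)
    blowUpArc-exactlyOne (1F , _) (2F , _) _   = inj₁ (refl , refl)
    blowUpArc-exactlyOne (2F , _) (0F , _) _   = inj₁ (refl , refl)
    blowUpArc-exactlyOne (1F , _) (0F , _) _   = inj₂ (refl , refl)
    blowUpArc-exactlyOne (2F , _) (1F , _) _   = inj₂ (refl , refl)
    blowUpArc-exactlyOne (0F , _) (2F , _) _   = inj₂ (refl , refl)

    blowUp-isTournament : IsTournament (blowUp D)
    blowUp-isTournament = record
      { loopless   = λ u → blowUpArc-loopless (remQuot n u)
      ; exactlyOne = λ u v u≢v → blowUpArc-exactlyOne (remQuot n u) (remQuot n v) (u≢v ∘ remQuot-injective)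
      }
      where
      remQuot-injective : ∀ {u v} → remQuot n u ≡ remQuot n v → u ≡ v
      remQuot-injective {u} {v} eq = begin
        u                             ≡⟨ combine-remQuot n u ⟨
        uncurry combine (remQuot n u) ≡⟨ cong (uncurry combine) eq ⟩
        uncurry combine (remQuot n v) ≡⟨ combine-remQuot n v ⟩
        v                             ∎
        where open ≡-Reasoning

  outDegreeIn-blowUp : (D : Digraph n) (S : Fin (3 * n) → Bool) (i : Fin 3) (w : Fin n) →
    outDegreeIn (blowUp D) S (combine i w) ≡ outDegreeIn D (part S i) w + count (part S (next i))
  outDegreeIn-blowUp D S i w = begin
    outDegreeIn (blowUp D) S v                         ≡⟨ count-combine (λ u → S u ∧ blowUp D v u) ⟩
    sum₃ (λ j → count (λ z → part S j z ∧ blowUp D v (combine j z)))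
      ≡⟨ sum₃-cong (λ j → count-cong (λ z → cong (part S j z ∧_) (blowUp-combine D i j w z))) ⟩
    sum₃ (λ j → count (λ z → part S j z ∧ blowUpArc D (i , w) (j , z)))
      ≡⟨ by-copy i ⟩
    outDegreeIn D (part S i) w + count (part S (next i)) ∎
    where
    open ≡-Reasoning
    v : Fin (3 * n)
    v = combine i w
    a : Fin 3 → ℕ
    a j = count (part S j)
    by-copy : ∀ i → sum₃ (λ j → count (λ z → part S j z ∧ blowUpArc D (i , w) (j , z)))
                      ≡ outDegreeIn D (part S i) w + a (next i)
    by-copy 0F = cong (outDegreeIn D (part S 0F) w +_)
      (trans (cong₂ _+_ (count-∧-true (part S 1F)) (count-∧-false (part S 2F))) (+-identityʳ (a 1F)))
    by-copy 1F = cong₂ _+_ (count-∧-false (part S 0F))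
      (cong (outDegreeIn D (part S 1F) w +_) (count-∧-true (part S 2F)))
    by-copy 2F = trans (cong₂ _+_ (count-∧-true (part S 0F))
      (cong (_+ outDegreeIn D (part S 2F) w) (count-∧-false (part S 1F))))
      (+-comm (a 0F) _)

T : (k : ℕ) → Digraph (3 ^ k)
T zero    = λ _ _ → false
T (suc k) = blowUp (T k)

regularDegree : ℕ → ℕ
regularDegree zero    = 0
regularDegree (suc k) = 1 + 3 * regularDegree k

3^k≡2*regularDegree+1 : ∀ k → 3 ^ k ≡ 2 * regularDegree k + 1
3^k≡2*regularDegree+1 zero    = refl
3^k≡2*regularDegree+1 (suc k) = trans (cong (3 *_) (3^k≡2*regularDegree+1 k)) (identity (regularDegree k))
  where
  identity : ∀ h → 3 * (2 * h + 1) ≡ 2 * (1 + 3 * h) + 1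
  identity = solve-∀

k≤regularDegree : ∀ k → k ≤ regularDegree k
k≤regularDegree zero    = z≤n
k≤regularDegree (suc k) = s≤s (≤-trans (k≤regularDegree k) (m≤n*m (regularDegree k) 3))

T-isTournament : ∀ k → IsTournament (T k)
T-isTournament zero    = record { loopless = λ _ → refl ; exactlyOne = λ { 0F 0F 0≢0 → ⊥-elim (0≢0 refl) } }
T-isTournament (suc k) = blowUp-isTournament (T-isTournament k)

T-regular : ∀ k v → count (T k v) ≡ regularDegree k
T-regular zero    _ = refl
T-regular (suc k) v with combine-surjective {3} {3 ^ k} v
... | i , w , refl = begin
  outDegreeIn (blowUp (T k)) (λ _ → true) (combine i w)  ≡⟨ outDegreeIn-blowUp (T k) (λ _ → true) i w ⟩
  count (T k w) + count {3 ^ k} (λ _ → true)            ≡⟨ cong₂ _+_ (T-regular k w) (count-true (3 ^ k)) ⟩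
  h + 3 ^ k                                              ≡⟨ cong (h +_) (3^k≡2*regularDegree+1 k) ⟩
  h + (2 * h + 1)                                        ≡⟨ identity h ⟩
  1 + 3 * h                                              ∎
  where
  open ≡-Reasoning
  h = regularDegree k
  identity : ∀ h → h + (2 * h + 1) ≡ 1 + 3 * h
  identity = solve-∀

data Low (k h s d : ℕ) : Set where
  low-degree : 2 * d + k ≤ h → Low k h s d
  large-set  : 2 * d + k + h + 2 ≤ 2 * s → Low k h s d

module _ {k h : ℕ} where
  open ≤-Reasoning

  small-set⇒low-degree : ∀ {s d} → s ≤ h → Low k h s d → 2 * d + k ≤ h
  small-set⇒low-degree     _   (low-degree p) = p
  small-set⇒low-degree {s} {d} s≤h (large-set p) = +-cancelʳ-≤ h (2 * d + k) h (begin
    2 * d + k + h      ≤⟨ m≤m+n _ 2 ⟩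
    2 * d + k + h + 2  ≤⟨ p ⟩
    2 * s              ≤⟨ *-monoʳ-≤ 2 s≤h ⟩
    2 * h              ≡⟨ cong (h +_) (+-identityʳ h) ⟩
    h + h              ∎)

  Low⇒large-set : ∀ {x d} → h < x → Low k h x d → 2 * d + k + h + 2 ≤ 2 * x
  Low⇒large-set {x} {d} h<x (low-degree p) = begin
    2 * d + k + h + 2  ≤⟨ +-monoˡ-≤ 2 (+-monoˡ-≤ h p) ⟩
    h + h + 2          ≡⟨ identity h ⟩
    2 * suc h          ≤⟨ *-monoʳ-≤ 2 h<x ⟩
    2 * x              ∎
    where
    identity : ∀ h → h + h + 2 ≡ 2 * suc h
    identity = solve-∀
  Low⇒large-set _ (large-set p) = p

  low-degree-step : ∀ {x y d} → y ≤ h → x + y ≤ 2 * h + 1 → Low k h x d → 2 * (d + y) + suc k ≤ 1 + 3 * h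
  low-degree-step {x} {y} {d} y≤h _ (low-degree p) = begin
    2 * (d + y) + suc k      ≡⟨ identity d y k ⟩
    (2 * d + k) + (2 * y + 1) ≤⟨ +-mono-≤ p (+-monoˡ-≤ 1 (*-monoʳ-≤ 2 y≤h)) ⟩
    h + (2 * h + 1)          ≡⟨ identity′ h ⟩
    1 + 3 * h                ∎
    where
    identity : ∀ d y k → 2 * (d + y) + suc k ≡ (2 * d + k) + (2 * y + 1)
    identity = solve-∀
    identity′ : ∀ h → h + (2 * h + 1) ≡ 1 + 3 * h
    identity′ = solve-∀
  low-degree-step {x} {y} {d} _ x+y≤ (large-set p) = +-cancelʳ-≤ (h + 1) _ _ (begin
    2 * (d + y) + suc k + (h + 1)  ≡⟨ identity d y k h ⟩
    (2 * d + k + h + 2) + 2 * y    ≤⟨ +-monoˡ-≤ (2 * y) p ⟩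
    2 * x + 2 * y                  ≡⟨ *-distribˡ-+ 2 x y ⟨
    2 * (x + y)                    ≤⟨ *-monoʳ-≤ 2 x+y≤ ⟩
    2 * (2 * h + 1)                ≡⟨ identity′ h ⟩
    1 + 3 * h + (h + 1)            ∎)
    where
    identity : ∀ d y k h → 2 * (d + y) + suc k + (h + 1) ≡ (2 * d + k + h + 2) + 2 * y
    identity = solve-∀
    identity′ : ∀ h → 2 * (2 * h + 1) ≡ 1 + 3 * h + (h + 1)
    identity′ = solve-∀

  large-set-step : ∀ {x y z d} → h < x → h < z → Low k h x d →
    2 * (d + y) + suc k + (1 + 3 * h) + 2 ≤ 2 * (x + (y + z))
  large-set-step {x} {y} {z} {d} h<x h<z low = begin
    2 * (d + y) + suc k + (1 + 3 * h) + 2  ≡⟨ identity d y k h ⟩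
    (2 * d + k + h + 2) + 2 * y + 2 * suc h ≤⟨ +-mono-≤ (+-monoˡ-≤ (2 * y) (Low⇒large-set h<x low)) (*-monoʳ-≤ 2 h<z) ⟩
    2 * x + 2 * y + 2 * z                   ≡⟨ identity′ x y z ⟩
    2 * (x + (y + z))                       ∎
    where
    identity : ∀ d y k h → 2 * (d + y) + suc k + (1 + 3 * h) + 2 ≡ (2 * d + k + h + 2) + 2 * y + 2 * suc h
    identity = solve-∀
    identity′ : ∀ x y z → 2 * x + 2 * y + 2 * z ≡ 2 * (x + (y + z))
    identity′ = solve-∀

sum₃-rotate : ∀ a i → sum₃ a ≡ a i + (a (next i) + a (next (next i)))
sum₃-rotate a 0F = refl
sum₃-rotate a 1F = rotate (a 0F) (a 1F) (a 2F)
  where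
  rotate : ∀ x y z → x + (y + z) ≡ y + (z + x)
  rotate = solve-∀
sum₃-rotate a 2F = rotate (a 0F) (a 1F) (a 2F)
  where
  rotate : ∀ x y z → x + (y + z) ≡ z + (x + y)
  rotate = solve-∀

GoodCopy : ℕ → (Fin 3 → ℕ) → Fin 3 → Set
GoodCopy h a i = 1 ≤ a i ×
  (a (next i) ≤ h × a i + a (next i) ≤ 2 * h + 1 ⊎ h < a i × h < a (next (next i)))

Low-step : ∀ {k h d} (a : Fin 3 → ℕ) {i} → GoodCopy h a i → Low k h (a i) d →
  Low (suc k) (1 + 3 * h) (sum₃ a) (d + a (next i))
Low-step a (_ , inj₁ (small , sum≤)) low = low-degree (low-degree-step small sum≤ low)
Low-step {k} {h} {d} a {i} (_ , inj₂ (h<aᵢ , h<aᵢ₊₂)) low =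
  large-set (subst (λ s → 2 * (d + a (next i)) + suc k + (1 + 3 * h) + 2 ≤ 2 * s) (sym (sum₃-rotate a i))
                   (large-set-step h<aᵢ h<aᵢ₊₂ low))

positive-summand : ∀ m n → 1 ≤ m + n → 1 ≤ m ⊎ 1 ≤ n
positive-summand (suc _) _ _ = inj₁ (s≤s z≤n)
positive-summand zero    _ p = inj₂ p

positive-part : ∀ a → 1 ≤ sum₃ a → ∃ λ i → 1 ≤ a i
positive-part a p with positive-summand (a 0F) _ p
... | inj₁ q = 0F , q
... | inj₂ q with positive-summand (a 1F) (a 2F) q
...   | inj₁ r = 1F , r
...   | inj₂ r = 2F , r

m≤h∧n≤h⇒m+n≤2h+1 : ∀ {h x y} → x ≤ h → y ≤ h → x + y ≤ 2 * h + 1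
m≤h∧n≤h⇒m+n≤2h+1 {h} {x} {y} x≤h y≤h = begin
  x + y     ≤⟨ +-mono-≤ x≤h y≤h ⟩
  h + h     ≡⟨ cong (h +_) (+-identityʳ h) ⟨
  2 * h     ≤⟨ m≤m+n (2 * h) 1 ⟩
  2 * h + 1 ∎
  where open ≤-Reasoning

module _ (h : ℕ) (a : Fin 3 → ℕ) where

  twoLarge : ∀ {i} → h < a i → h < a (next (next i)) → GoodCopy h a i
  twoLarge h<aᵢ h<aᵢ₊₂ = ≤-trans (s≤s z≤n) h<aᵢ , inj₂ (h<aᵢ , h<aᵢ₊₂)

  oneLarge : ∀ b → a b ≤ 2 * h + 1 → h < a b → a (next b) ≤ h → a (next (next b)) ≤ h → ∃ (GoodCopy h a)
  oneLarge b aᵦ≤ h<aᵦ aᵦ₊₁≤h aᵦ₊₂≤h with 1 ≤? a (next b)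
  ... | yes pos = next b , pos , inj₁ (aᵦ₊₂≤h , m≤h∧n≤h⇒m+n≤2h+1 aᵦ₊₁≤h aᵦ₊₂≤h)
  ... | no ¬pos = b , ≤-trans (s≤s z≤n) h<aᵦ , inj₁ (aᵦ₊₁≤h , aᵦ+aᵦ₊₁≤)
    where
    aᵦ+aᵦ₊₁≤ : a b + a (next b) ≤ 2 * h + 1
    aᵦ+aᵦ₊₁≤ rewrite n<1⇒n≡0 (≰⇒> ¬pos) | +-identityʳ (a b) = aᵦ≤

  noLarge : (∀ j → a j ≤ h) → 1 ≤ sum₃ a → ∃ (GoodCopy h a)
  noLarge small nonempty with i , pos ← positive-part a nonempty =
    i , pos , inj₁ (small (next i) , m≤h∧n≤h⇒m+n≤2h+1 (small i) (small (next i)))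

  choose-copy : (∀ j → a j ≤ 2 * h + 1) → 1 ≤ sum₃ a → ∃ (GoodCopy h a)
  choose-copy a≤ nonempty with h <? a 0F | h <? a 1F | h <? a 2F
  ... | yes b₀ | _      | yes b₂ = 0F , twoLarge b₀ b₂
  ... | yes b₀ | yes b₁ | no _   = 1F , twoLarge b₁ b₀
  ... | no _   | yes b₁ | yes b₂ = 2F , twoLarge b₂ b₁
  ... | yes b₀ | no s₁  | no s₂  = oneLarge 0F (a≤ 0F) b₀ (≮⇒≥ s₁) (≮⇒≥ s₂)
  ... | no s₀  | yes b₁ | no s₂  = oneLarge 1F (a≤ 1F) b₁ (≮⇒≥ s₂) (≮⇒≥ s₀)
  ... | no s₀  | no s₁  | yes b₂ = oneLarge 2F (a≤ 2F) b₂ (≮⇒≥ s₀) (≮⇒≥ s₁)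
  ... | no s₀  | no s₁  | no s₂  = noLarge small nonempty
    where
    small : ∀ j → a j ≤ h
    small 0F = ≮⇒≥ s₀
    small 1F = ≮⇒≥ s₁
    small 2F = ≮⇒≥ s₂

count-part-≤ : ∀ k (S : Fin (3 ^ suc k) → Bool) j → count (part {3 ^ k} S j) ≤ 2 * regularDegree k + 1
count-part-≤ k S j =
  subst (count (part {3 ^ k} S j) ≤_) (3^k≡2*regularDegree+1 k) (count-≤ (part {3 ^ k} S j))

∃-low-vertex : ∀ k (S : Fin (3 ^ k) → Bool) → 1 ≤ count S →
  ∃ λ v → S v ≡ true × Low k (regularDegree k) (count S) (outDegreeIn (T k) S v)
∃-low-vertex zero S nonempty with S 0F in S0 | nonempty
... | true  | _ = 0F , S0 , low-degree z≤n
... | false | ()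
∃-low-vertex (suc k) S nonempty
  with i , good@(nonemptyᵢ , _) ← choose-copy (regularDegree k) (count ∘ part {3 ^ k} S) (count-part-≤ k S)
                                            (subst (1 ≤_) (count-combine {3 ^ k} S) nonempty)
  with w , Sw , low ← ∃-low-vertex k (part {3 ^ k} S i) nonemptyᵢ
  = combine i w , Sw ,
    subst₂ (Low (suc k) (regularDegree (suc k)))
           (sym (count-combine {3 ^ k} S)) (sym (outDegreeIn-blowUp (T k) S i w))
           (Low-step (count ∘ part {3 ^ k} S) {i} good low)

small-sets-bound : ∀ k (X : Subset (3 ^ k)) → ∣ X ∣ ≤ regularDegree k →
  2 * minOutDegIn (T k) X + k ≤ regularDegree k
small-sets-bound k X ∣X∣≤h with count (Vec.lookup X) in ∣X∣≡
... | zero = subst (λ m → 2 * m + k ≤ regularDegree k) (sym (minOutDegIn-∅ (T k) X ∣X∣≡)) (k≤regularDegree k)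
... | suc _ with v , v∈X , low ← ∃-low-vertex k (Vec.lookup X) (subst (1 ≤_) (sym ∣X∣≡) (s≤s z≤n)) =
  ≤-trans (+-monoˡ-≤ k (*-monoʳ-≤ 2 (minOutDegIn-≤ (T k) X v∈X)))
    (small-set⇒low-degree (subst (_≤ regularDegree k) (∣∣≡count X) ∣X∣≤h) low)

regularDegree-unique : ∀ k h → 2 * h + 1 ≡ 3 ^ k → h ≡ regularDegree k
regularDegree-unique k h e =
  *-cancelˡ-≡ h (regularDegree k) 2 (+-cancelʳ-≡ 1 (2 * h) _ (trans e (3^k≡2*regularDegree+1 k)))

theorem2 : (k h : ℕ) → 2 * h + 1 ≡ 3 ^ k →
    Σ (Digraph (3 ^ k)) λ T →
      IsTournament T
      × (∀ v → outDeg T v ≡ h)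
      × (∀ (X : Subset (3 ^ k)) → ∣ X ∣ ≤ h → 2 * minOutDegIn T X + k ≤ h)
theorem2 k h 2h+1≡3^k with refl ← regularDegree-unique k h 2h+1≡3^k =
  T k , T-isTournament k , (λ v → trans (outDeg≡count (T k) v) (T-regular k v)) , small-sets-bound k
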